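{- If $a,b$ are integers with $a\geq 0$ and $b>0$, then $\dfrac{(a+2b)!}{a!\,b!\,b!}$ is an even integer. -}

{-# OPTIONS --safe #-}
module Submission where

-- (a + 2b)! / (a! b! b!) = C(a + 2b, a) · C(2b, b), and the central binomial
-- coefficient C(2b, b) is even for b > 0: by Pascal's rule it is
-- C(2b-1, b-1) + C(2b-1, b), and the two summands are equal by symmetry.

open import Data.Nat using (ℕ; _+_; _*_; _∸_; _<_; _≤_; _!; suc; s≤s; z≤n)
open import Data.Nat.Combinatorics
  using (_C_; nCk≡n!/k![n-k]!; k![n∸k]!∣n!; nCk≡nC[n∸k]; nCk+nC[k+1]≡[n+1]C[k+1])
open import Data.Nat.DivMod using (m*[n/m]≡n)
open import Data.Nat.Properties using (_!*_!≢0; m+n∸m≡n; m+n∸n≡m; m≤n+m; m≤m+n; +-identityʳ)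
open import Data.Nat.Tactic.RingSolver using (solve-∀)
open import Data.Product using (∃-syntax; _,_)
open import Relation.Binary.PropositionalEquality
  using (_≡_; sym; trans; cong; module ≡-Reasoning)

k!*[n∸k]!*nCk≡n! : ∀ {n k} → k ≤ n → k ! * (n ∸ k) ! * (n C k) ≡ n !
k!*[n∸k]!*nCk≡n! {n} {k} k≤n =
  trans (cong (k ! * (n ∸ k) ! *_) (nCk≡n!/k![n-k]! k≤n))
        (m*[n/m]≡n {{k !* (n ∸ k) !≢0}} (k![n∸k]!∣n! k≤n))

m!*n!*[m+n]Cm≡[m+n]! : ∀ m n → m ! * n ! * ((m + n) C m) ≡ (m + n) !
m!*n!*[m+n]Cm≡[m+n]! m n =
  trans (cong (λ k → m ! * k ! * ((m + n) C m)) (sym (m+n∸m≡n m n)))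
        (k!*[n∸k]!*nCk≡n! (m≤m+n m n))

[1+n+1+n]C[1+n]≡2*[n+1+n]Cn : ∀ n → (suc n + suc n) C suc n ≡ 2 * ((n + suc n) C n)
[1+n+1+n]C[1+n]≡2*[n+1+n]Cn n = begin
  (suc n + suc n) C suc n                ≡⟨ nCk+nC[k+1]≡[n+1]C[k+1] (n + suc n) n ⟨
  (n + suc n) C n + (n + suc n) C suc n  ≡⟨ cong ((n + suc n) C n +_) symmetric ⟩
  (n + suc n) C n + (n + suc n) C n      ≡⟨ cong ((n + suc n) C n +_) (+-identityʳ _) ⟨
  2 * ((n + suc n) C n)                  ∎
  where
  open ≡-Reasoning
  symmetric : (n + suc n) C suc n ≡ (n + suc n) C n
  symmetric = trans (nCk≡nC[n∸k] (m≤n+m (suc n) n))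
                    (cong ((n + suc n) C_) (m+n∸n≡m n (suc n)))

lemma5 : (a b : ℕ) → 0 < b →
    ∃[ k ] ((a + 2 * b) ! ≡ (a ! * b ! * b !) * (2 * k))
lemma5 a b@(suc c) (s≤s z≤n) = half-central * outer , (begin
  (a + 2 * b) !                                  ≡⟨ m!*n!*[m+n]Cm≡[m+n]! a (2 * b) ⟨
  a ! * (2 * b) ! * outer                        ≡⟨ cong (λ t → a ! * t * outer) [2b]!-split ⟩
  a ! * (b ! * b ! * (2 * half-central)) * outer  ≡⟨ regroup (a !) (b !) half-central outer ⟩
  a ! * b ! * b ! * (2 * (half-central * outer))  ∎)
  where
  open ≡-Reasoning
  outer half-central : ℕ
  outer        = (a + 2 * b) C a
  half-central = (c + b) C c

  [2b]!-split : (2 * b) ! ≡ b ! * b ! * (2 * half-central)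
  [2b]!-split = begin
    (2 * b) !                       ≡⟨ cong (λ m → (b + m) !) (+-identityʳ b) ⟩
    (b + b) !                       ≡⟨ m!*n!*[m+n]Cm≡[m+n]! b b ⟨
    b ! * b ! * ((b + b) C b)       ≡⟨ cong (b ! * b ! *_) ([1+n+1+n]C[1+n]≡2*[n+1+n]Cn c) ⟩
    b ! * b ! * (2 * half-central)  ∎

  regroup : ∀ x y h z → x * (y * y * (2 * h)) * z ≡ x * y * y * (2 * (h * z))
  regroup = solve-∀
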